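{- Let $\mathfrak A$ be a structure. Consider the directed system indexed by the positive integers ordered by (strict) divisibility, with $\mathfrak A_n:=\mathfrak A^n$ and, for $n<m$ with $n\mid m$, the embedding $e_{(n,m)}:\mathfrak A^n\to\mathfrak A^m$ sending $\bar a\in A^n$ to the concatenation $\bar a\bar a\cdots\bar a$ of $m/n$ copies of $\bar a$. Then $\mathfrak A^{\mathrm{per}}$ is isomorphic to the direct limit $\lim_n\mathfrak A^n$ of this system.
   Context: A function $\vec a:\mathbb N\to A$ is periodic if for some $k\ge1$, $\vec a(i)=\vec a(i\bmod k)$ for all $i$; the periodic power $\mathfrak A^{\mathrm{per}}$ is the substructure of the direct power $\mathfrak A^{\mathbb N}$ on the periodic functions. For a directed system of embeddings $(e_{(i,j)}:\mathfrak A_i\to\mathfrak A_j)_{i\prec j}$ (with $e_{(i,k)}=e_{(j,k)}\circ e_{(i,j)}$), a cone is a structure $\mathfrak A^*$ with embeddings $e^*_i:\mathfrak A_i\to\mathfrak A^*$ with $e^*_j\circ e_{(i,j)}=e^*_i$; the direct limit is a cone such that for every other cone $(\tilde{\mathfrak A},(\tilde e_i))$ there is a unique embedding $e:\mathfrak A^*\to\tilde{\mathfrak A}$ with $e\circ e^*_i=\tilde e_i$ for all $i$. -}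

module Defs where

open import Level using (Level; _⊔_; Setω)
open import Data.Nat as ℕ using (ℕ; _<_; _≤_; _*_; _%_; NonZero; >-nonZero; s≤s; z≤n)
open import Data.Nat.Properties using (*-mono-≤)
open import Data.Nat.DivMod using (m%n<n; m∣n⇒o%n%m≡o%m)
open import Data.Nat.Divisibility using (_∣_; ∣-refl; ∣-trans; ∣m⇒∣m*n; ∣n⇒∣m*n)
open import Data.Fin using (Fin; toℕ; fromℕ<)
import Data.Fin as F
open import Data.Product using (Σ; _×_; _,_; proj₁; proj₂)
open import Function.Bundles using (_⇔_)
open import Relation.Binary.Structures using (IsEquivalence)
open import Relation.Binary.PropositionalEquality using (_≡_; subst)

record Signature : Set₁ where
  field
    Fun      : Set
    funArity : Fun → ℕ
    Rel      : Set
    relArity : Rel → ℕ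

record Structure (σ : Signature) (c ℓ r : Level) : Set (Level.suc (c ⊔ ℓ ⊔ r)) where
  open Signature σ
  field
    Carrier  : Set c
    _≈_      : Carrier → Carrier → Set ℓ
    isEquiv  : IsEquivalence _≈_
    funI     : (f : Fun) → (Fin (funArity f) → Carrier) → Carrier
    funI-cong : ∀ f (xs ys : Fin (funArity f) → Carrier) →
                (∀ i → xs i ≈ ys i) → funI f xs ≈ funI f ys
    relI     : (R : Rel) → (Fin (relArity R) → Carrier) → Set r
    relI-cong : ∀ R (xs ys : Fin (relArity R) → Carrier) →
                (∀ i → xs i ≈ ys i) → relI R xs → relI R ys
  open IsEquivalence isEquiv public

open Structure

record Embedding {σ : Signature} {c ℓ r c' ℓ' r'}
                 (A : Structure σ c ℓ r) (B : Structure σ c' ℓ' r')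
                 : Set (c ⊔ ℓ ⊔ r ⊔ c' ⊔ ℓ' ⊔ r') where
  open Signature σ
  field
    map      : Carrier A → Carrier B
    cong     : ∀ {x y} → _≈_ A x y → _≈_ B (map x) (map y)
    injective : ∀ {x y} → _≈_ B (map x) (map y) → _≈_ A x y
    hom-fun  : ∀ f (xs : Fin (funArity f) → Carrier A) →
               _≈_ B (map (funI A f xs)) (funI B f (λ i → map (xs i)))
    hom-rel  : ∀ R (xs : Fin (relArity R) → Carrier A) →
               relI A R xs ⇔ relI B R (λ i → map (xs i))

open Embedding public using (map)

module _ {σ : Signature} {c ℓ r : Level} where
  open Signature σ

  Power : (I : Set) → Structure σ c ℓ r → Structure σ c ℓ r
  Power I A = record
    { Carrier  = I → Carrier A
    ; _≈_      = λ a b → ∀ i → _≈_ A (a i) (b i)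
    ; isEquiv  = record
        { refl  = λ i → refl A
        ; sym   = λ p i → sym A (p i)
        ; trans = λ p q i → trans A (p i) (q i) }
    ; funI     = λ f xs i → funI A f (λ j → xs j i)
    ; funI-cong = λ f xs ys p i → funI-cong A f _ _ (λ j → p j i)
    ; relI     = λ R xs → ∀ i → relI A R (λ j → xs j i)
    ; relI-cong = λ R xs ys p h i → relI-cong A R _ _ (λ j → p j i) (h i)
    }

  FinPower : ℕ → Structure σ c ℓ r → Structure σ c ℓ r
  FinPower n A = Power (Fin n) A

mod : ℕ → (k : ℕ) → 1 ≤ k → ℕ
mod i k p = (i % k) {{>-nonZero p}}

IsPeriodic : ∀ {σ c ℓ r} (A : Structure σ c ℓ r) → (ℕ → Carrier A) → Set ℓ
IsPeriodic A a = Σ ℕ λ k → Σ (1 ≤ k) λ p → ∀ i → _≈_ A (a i) (a (mod i k p))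

private
  prodF : ∀ n → (Fin n → ℕ) → ℕ
  prodF ℕ.zero    k = 1
  prodF (ℕ.suc n) k = k F.zero * prodF n (λ j → k (F.suc j))

  prodF-pos : ∀ n (k : Fin n → ℕ) → (∀ j → 1 ≤ k j) → 1 ≤ prodF n k
  prodF-pos ℕ.zero    k p = s≤s z≤n
  prodF-pos (ℕ.suc n) k p = *-mono-≤ (p F.zero) (prodF-pos n _ (λ j → p (F.suc j)))

  prodF-∣ : ∀ n (k : Fin n → ℕ) j → k j ∣ prodF n k
  prodF-∣ (ℕ.suc n) k F.zero    = ∣m⇒∣m*n _ ∣-refl
  prodF-∣ (ℕ.suc n) k (F.suc j) = ∣n⇒∣m*n (k F.zero) (prodF-∣ n (λ j → k (F.suc j)) j)

  mod-mod : ∀ i K k (pK : 1 ≤ K) (pk : 1 ≤ k) → k ∣ K →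
            mod (mod i K pK) k pk ≡ mod i k pk
  mod-mod i K k pK pk d =
    m∣n⇒o%n%m≡o%m k K i {{>-nonZero pk}} {{>-nonZero pK}} d

module _ {σ : Signature} {c ℓ r : Level} (A : Structure σ c ℓ r) where
  open Signature σ
  private
    Aℕ = Power ℕ A

  periodic-closed : ∀ f (xs : Fin (funArity f) → Σ (ℕ → Carrier A) (IsPeriodic A)) →
                    IsPeriodic A (funI Aℕ f (λ j → proj₁ (xs j)))
  periodic-closed f xs = K , pK , λ i → funI-cong A f _ _ (λ j → step j i)
    where
      n  = funArity f
      ks = λ j → proj₁ (proj₂ (xs j))
      K  = prodF n ks
      pK = prodF-pos n ks (λ j → proj₁ (proj₂ (proj₂ (xs j))))
      step : ∀ j i → _≈_ A (proj₁ (xs j) i) (proj₁ (xs j) (mod i K pK))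
      step j i =
        let a  = proj₁ (xs j)
            pk = proj₁ (proj₂ (proj₂ (xs j)))
            h  = proj₂ (proj₂ (proj₂ (xs j)))
            e  = mod-mod i K (ks j) pK pk (prodF-∣ n ks j)
        in trans A (h i)
             (trans A (subst (λ t → _≈_ A (a t) (a (mod (mod i K pK) (ks j) pk)))
                             e (refl A))
                      (sym A (h (mod i K pK))))

  PerPower : Structure σ (c ⊔ ℓ) ℓ r
  PerPower = record
    { Carrier  = Σ (ℕ → Carrier A) (IsPeriodic A)
    ; _≈_      = λ a b → _≈_ Aℕ (proj₁ a) (proj₁ b)
    ; isEquiv  = record
        { refl  = refl Aℕ
        ; sym   = sym Aℕ
        ; trans = trans Aℕ }
    ; funI     = λ f xs → funI Aℕ f (λ j → proj₁ (xs j)) , periodic-closed f xs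
    ; funI-cong = λ f xs ys p → funI-cong Aℕ f _ _ p
    ; relI     = λ R xs → relI Aℕ R (λ j → proj₁ (xs j))
    ; relI-cong = λ R xs ys p → relI-cong Aℕ R _ _ p
    }

-- The directed system: index set the positive integers, n ≺ m iff
-- n < m and n ∣ m; 𝔄_n = 𝔄^n; e_(n,m) maps ā to ā ā ⋯ ā (m/n copies),
-- i.e. the i-th coordinate (0 ≤ i < m) of the image is ā(i mod n).

concatCopies : ∀ {a} {X : Set a} (n m : ℕ) .{{_ : NonZero n}} →
               (Fin n → X) → (Fin m → X)
concatCopies n m x i = x (fromℕ< (m%n<n (toℕ i) n))

_≺_ : ℕ → ℕ → Set
n ≺ m = n < m × n ∣ m

module _ {σ : Signature} {c ℓ r : Level} (A : Structure σ c ℓ r) where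

  ConeMaps : ∀ {c' ℓ' r'} → Structure σ c' ℓ' r' → Set _
  ConeMaps B = (n : ℕ) .{{_ : NonZero n}} → Embedding (FinPower n A) B

  IsCone : ∀ {c' ℓ' r'} (B : Structure σ c' ℓ' r') → ConeMaps B → Set _
  IsCone B e = (n m : ℕ) .{{_ : NonZero n}} .{{_ : NonZero m}} → n ≺ m →
               (x : Fin n → Carrier A) →
               _≈_ B (map (e m) (concatCopies n m x)) (map (e n) x)

  record IsDirectLimit {c' ℓ' r'} (B : Structure σ c' ℓ' r') : Setω where
    field
      cone    : ConeMaps B
      isCone  : IsCone B cone
      mediate : ∀ {c'' ℓ'' r''} (C : Structure σ c'' ℓ'' r'')
                (ẽ : ConeMaps C) → IsCone C ẽ → Embedding B C
      commute : ∀ {c'' ℓ'' r''} (C : Structure σ c'' ℓ'' r'')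
                (ẽ : ConeMaps C) (ẽ-cone : IsCone C ẽ) →
                (n : ℕ) .{{_ : NonZero n}} (x : Fin n → Carrier A) →
                _≈_ C (map (mediate C ẽ ẽ-cone) (map (cone n) x)) (map (ẽ n) x)
      unique  : ∀ {c'' ℓ'' r''} (C : Structure σ c'' ℓ'' r'')
                (ẽ : ConeMaps C) (ẽ-cone : IsCone C ẽ) (h : Embedding B C) →
                ((n : ℕ) .{{_ : NonZero n}} (x : Fin n → Carrier A) →
                   _≈_ C (map h (map (cone n) x)) (map (ẽ n) x)) →
                (y : Carrier B) → _≈_ C (map h y) (map (mediate C ẽ ẽ-cone) y)

-- A function with period k is the periodic extension of its first k values, so the maps
-- x ↦ x x x ⋯ form a cone into 𝔄^per whose images exhaust it. Given any other cone ẽ, the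
-- mediating map must send y of period k to ẽ_k(y(0) … y(k-1)); this does not depend on the
-- period, since two periods have a common strict multiple m and the cone condition identifies
-- both values with ẽ_m(y(0) … y(m-1)). Operations and relations are checked at a common period
-- of their finitely many arguments, where 𝔄^per agrees coordinatewise with 𝔄^K.
module Submission where

open import Defs hiding (mod)
open import Level using (Level)
open import Data.Nat using (ℕ; zero; suc; _%_; _*_; NonZero; >-nonZero; >-nonZero⁻¹; s≤s; z≤n)
open import Data.Nat.Properties using (≤-<-trans; m<m*n; m*n≢0)
open import Data.Nat.DivMod using (_mod_; m%n%n≡m%n; m<n⇒m%n≡m; m∣n⇒o%n%m≡o%m)
open import Data.Nat.Divisibility using (_∣_; ∣-refl; ∣⇒≤; ∣m⇒∣m*n; ∣n⇒∣m*n)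
open import Data.Fin using (Fin; toℕ)
import Data.Fin as Fin
open import Data.Fin.Properties using (toℕ<n; toℕ-fromℕ<; fromℕ<-cong; fromℕ<-toℕ)
open import Data.Product using (_,_; proj₁; proj₂)
open import Function.Base using (_∘_; it)
open import Function.Bundles using (_⇔_; mk⇔)
open import Function.Properties.Equivalence using () renaming (trans to ⇔-trans)
open import Relation.Binary.PropositionalEquality using (_≡_; _≗_; sym; trans; cong)

open Structure using (Carrier; funI; relI)

relI-cong-⇔ : ∀ {σ c ℓ r} (B : Structure σ c ℓ r) R
              {xs ys : Fin (Signature.relArity σ R) → Carrier B} →
              (∀ i → Structure._≈_ B (xs i) (ys i)) → relI B R xs ⇔ relI B R ys
relI-cong-⇔ B R xs≈ys = mk⇔ (Structure.relI-cong B R _ _ xs≈ys)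
                            (Structure.relI-cong B R _ _ (Structure.sym B ∘ xs≈ys))

toℕ-mod : ∀ {n} .{{_ : NonZero n}} (i : Fin n) → toℕ i mod n ≡ i
toℕ-mod i = trans (fromℕ<-cong _ _ (m<n⇒m%n≡m (toℕ<n i)) _ (toℕ<n i)) (fromℕ<-toℕ i _)

%-mod-idem : ∀ i n .{{_ : NonZero n}} → i % n mod n ≡ i mod n
%-mod-idem i n = fromℕ<-cong _ _ (m%n%n≡m%n i n) _ _

toℕ-mod-mod : ∀ i {n m} .{{_ : NonZero n}} .{{_ : NonZero m}} → n ∣ m →
              toℕ (i mod m) mod n ≡ i mod n
toℕ-mod-mod i {n} {m} n∣m =
  fromℕ<-cong _ _ (trans (cong (_% n) (toℕ-fromℕ< _)) (m∣n⇒o%n%m≡o%m n m i n∣m)) _ _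

≺-*2 : ∀ {k m} .{{_ : NonZero m}} → k ∣ m → k ≺ (m * 2)
≺-*2 {m = m} k∣m = ≤-<-trans (∣⇒≤ k∣m) (m<m*n m 2 (s≤s (s≤s z≤n))) , ∣m⇒∣m*n 2 k∣m

module _ {a} {X : Set a} where

  restrict : (k : ℕ) → (ℕ → X) → Fin k → X
  restrict k x = x ∘ toℕ

  -- The n-periodic function x(0) … x(n-1) x(0) …; note concatCopies n m x = restrict m (extend n x).
  extend : (n : ℕ) .{{_ : NonZero n}} → (Fin n → X) → ℕ → X
  extend n x i = x (i mod n)

  restrict-extend : ∀ n .{{_ : NonZero n}} (x : Fin n → X) → restrict n (extend n x) ≗ x
  restrict-extend n x i = cong x (toℕ-mod i)

  extend-% : ∀ n .{{_ : NonZero n}} (x : Fin n → X) i → extend n x (i % n) ≡ extend n x i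
  extend-% n x i = cong x (%-mod-idem i n)

  extend-concatCopies : ∀ {n m} .{{_ : NonZero n}} .{{_ : NonZero m}} → n ∣ m →
                        (x : Fin n → X) → extend m (concatCopies n m x) ≗ extend n x
  extend-concatCopies n∣m x i = cong x (toℕ-mod-mod i n∣m)

module _ {σ : Signature} {c ℓ r : Level} (A : Structure σ c ℓ r) where
  open Signature σ
  private
    module A    = Structure A
    module Aper = Structure (PerPower A)

  _HasPeriod_ : (ℕ → A.Carrier) → (k : ℕ) .{{_ : NonZero k}} → Set ℓ
  a HasPeriod k = ∀ i → A._≈_ (a i) (a (i % k))

  hasPeriod-multiple : ∀ {a k m} .{{_ : NonZero k}} .{{_ : NonZero m}} → k ∣ m →
                       a HasPeriod k → a HasPeriod m
  hasPeriod-multiple {a} {k} {m} k∣m h i =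
    A.trans (h i) (A.sym (A.trans (h (i % m))
                                  (A.reflexive (cong a (m∣n⇒o%n%m≡o%m k m i k∣m)))))

  hasPeriod-resp : ∀ {a b k} .{{_ : NonZero k}} → (∀ i → A._≈_ (a i) (b i)) →
                   a HasPeriod k → b HasPeriod k
  hasPeriod-resp {k = k} a≈b h i = A.trans (A.sym (a≈b i)) (A.trans (h i) (a≈b (i % k)))

  extend-hasPeriod : ∀ n .{{_ : NonZero n}} (x : Fin n → A.Carrier) → extend n x HasPeriod n
  extend-hasPeriod n x i = A.reflexive (sym (extend-% n x i))

  extend-restrict : ∀ {a k} .{{_ : NonZero k}} → a HasPeriod k →
                    ∀ i → A._≈_ (extend k (restrict k a) i) (a i)
  extend-restrict {a} h i = A.trans (A.reflexive (cong a (toℕ-fromℕ< _))) (A.sym (h i))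

  agree-below-period : ∀ {a b m} .{{_ : NonZero m}} → a HasPeriod m → b HasPeriod m →
                       (∀ i → A._≈_ (restrict m a i) (restrict m b i)) →
                       ∀ i → A._≈_ (a i) (b i)
  agree-below-period {m = m} ha hb a≈b i =
    A.trans (A.sym (extend-restrict ha i)) (A.trans (a≈b (i mod m)) (extend-restrict hb i))

  funI-hasPeriod : ∀ f {k} .{{_ : NonZero k}} (as : Fin (funArity f) → ℕ → A.Carrier) →
                   (∀ j → as j HasPeriod k) → funI (Power ℕ A) f as HasPeriod k
  funI-hasPeriod f as h i = A.funI-cong f _ _ (λ j → h j i)

  restrict-relI⇔ : ∀ R {k} .{{_ : NonZero k}} (as : Fin (relArity R) → ℕ → A.Carrier) →
                   (∀ j → as j HasPeriod k) →
                   relI (Power ℕ A) R as ⇔ relI (FinPower k A) R (restrict k ∘ as)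
  restrict-relI⇔ R {k} as h = mk⇔
    (λ holds i → holds (toℕ i))
    (λ holds i → A.relI-cong R _ _ (λ j → extend-restrict (h j) i) (holds (i mod k)))

  record CommonPeriod {n} (as : Fin n → ℕ → A.Carrier) : Set ℓ where
    field
      period             : ℕ
      {{period-nonZero}} : NonZero period
      hasPeriod          : ∀ j → as j HasPeriod period

  commonPeriod : ∀ {n} (xs : Fin n → Aper.Carrier) → CommonPeriod (proj₁ ∘ xs)
  commonPeriod {zero}  xs = record { period = 1 ; period-nonZero = _ ; hasPeriod = λ () }
  commonPeriod {suc n} xs = record
    { period         = k * K
    ; period-nonZero = kK-nonZero
    ; hasPeriod      = λ { Fin.zero    → hasPeriod-multiple (∣m⇒∣m*n K ∣-refl) h
                         ; (Fin.suc j) → hasPeriod-multiple (∣n⇒∣m*n k ∣-refl) (hasPeriod j) }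
    }
    where
      open CommonPeriod (commonPeriod (xs ∘ Fin.suc)) renaming (period to K)
      k : ℕ
      k = proj₁ (proj₂ (xs Fin.zero))
      instance
        k-nonZero : NonZero k
        k-nonZero = >-nonZero (proj₁ (proj₂ (proj₂ (xs Fin.zero))))
        K-nonZero : NonZero K
        K-nonZero = period-nonZero
        kK-nonZero : NonZero (k * K)
        kK-nonZero = m*n≢0 k K
      h : proj₁ (xs Fin.zero) HasPeriod k
      h = proj₂ (proj₂ (proj₂ (xs Fin.zero)))

  extendCone : ConeMaps A (PerPower A)
  extendCone n = record
    { map       = λ x → extend n x , n , >-nonZero⁻¹ n , extend-hasPeriod n x
    ; cong      = λ x≈y i → x≈y (i mod n)
    ; injective = λ {x} {y} e i →
        A.trans (A.reflexive (sym (restrict-extend n x i)))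
                (A.trans (e (toℕ i)) (A.reflexive (restrict-extend n y i)))
    ; hom-fun   = λ _ _ _ → A.refl
    ; hom-rel   = λ R xs → mk⇔
        (λ holds i → holds (i mod n))
        (λ holds i → A.relI-cong R _ _ (λ j → A.reflexive (restrict-extend n (xs j) i))
                                       (holds (toℕ i)))
    }

  extendCone-isCone : IsCone A (PerPower A) extendCone
  extendCone-isCone n m (_ , n∣m) x i = A.reflexive (extend-concatCopies n∣m x i)

  module _ {c' ℓ' r'} (C : Structure σ c' ℓ' r') (ẽ : ConeMaps A C) (ẽ-cone : IsCone A C ẽ) where
    private module C = Structure C

    cone-restrict-≺ : ∀ {a k m} .{{_ : NonZero k}} .{{_ : NonZero m}} →
                      a HasPeriod k → k ≺ m →
                      C._≈_ (map (ẽ m) (restrict m a)) (map (ẽ k) (restrict k a))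
    cone-restrict-≺ {a} {k} {m} h k≺m =
      C.trans (Embedding.cong (ẽ m) (λ i → A.sym (extend-restrict h (toℕ i))))
              (ẽ-cone k m k≺m (restrict k a))

    cone-restrict-period-independent :
      ∀ {a} k k' .{{_ : NonZero k}} .{{_ : NonZero k'}} → a HasPeriod k → a HasPeriod k' →
      C._≈_ (map (ẽ k) (restrict k a)) (map (ẽ k') (restrict k' a))
    cone-restrict-period-independent (suc k) (suc k') h h' =
      C.trans (C.sym (cone-restrict-≺ h (≺-*2 (∣m⇒∣m*n (suc k') ∣-refl))))
              (cone-restrict-≺ h' (≺-*2 (∣n⇒∣m*n (suc k) ∣-refl)))

    mediateMap : Aper.Carrier → C.Carrier
    mediateMap (a , k , k≥1 , _) = map (ẽ k {{>-nonZero k≥1}}) (restrict k a)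

    mediateMap-period : ∀ y {K} .{{_ : NonZero K}} → proj₁ y HasPeriod K →
                        C._≈_ (mediateMap y) (map (ẽ K) (restrict K (proj₁ y)))
    mediateMap-period (a , k , k≥1 , h) {K} =
      cone-restrict-period-independent k K {{>-nonZero k≥1}} h

    mediateMap-cong : ∀ x y → x Aper.≈ y → C._≈_ (mediateMap x) (mediateMap y)
    mediateMap-cong (a , k , k≥1 , h) y a≈b =
      C.trans (Embedding.cong (ẽ k) (a≈b ∘ toℕ))
              (C.sym (mediateMap-period y (hasPeriod-resp a≈b h)))
      where instance k-nonZero : NonZero k
                     k-nonZero = >-nonZero k≥1

    mediateMap-funI : ∀ f (xs : Fin (funArity f) → Aper.Carrier) →
                      C._≈_ (mediateMap (Aper.funI f xs)) (C.funI f (mediateMap ∘ xs))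
    mediateMap-funI f xs =
      C.trans (mediateMap-period (Aper.funI f xs) (funI-hasPeriod f (proj₁ ∘ xs) hasPeriod))
        (C.trans (Embedding.hom-fun (ẽ period) f (restrict period ∘ proj₁ ∘ xs))
                 (C.funI-cong f _ _ (λ j → C.sym (mediateMap-period (xs j) (hasPeriod j)))))
      where
        open CommonPeriod (commonPeriod xs)
        instance K-nonZero : NonZero period
                 K-nonZero = period-nonZero

    mediateMap-injective : ∀ x y → C._≈_ (mediateMap x) (mediateMap y) → x Aper.≈ y
    mediateMap-injective x@(a , k , k≥1 , ha) y@(b , k' , k'≥1 , hb) e =
      agree-below-period ha' hb' (Embedding.injective (ẽ (k * k'))
        (C.trans (C.sym (mediateMap-period x ha')) (C.trans e (mediateMap-period y hb'))))
      where
        instance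
          k-nonZero : NonZero k
          k-nonZero = >-nonZero k≥1
          k'-nonZero : NonZero k'
          k'-nonZero = >-nonZero k'≥1
          kk'-nonZero : NonZero (k * k')
          kk'-nonZero = m*n≢0 k k'
        ha' : a HasPeriod (k * k')
        ha' = hasPeriod-multiple (∣m⇒∣m*n k' ∣-refl) ha
        hb' : b HasPeriod (k * k')
        hb' = hasPeriod-multiple (∣n⇒∣m*n k ∣-refl) hb

    mediateMap-relI : ∀ R (xs : Fin (relArity R) → Aper.Carrier) →
                      Aper.relI R xs ⇔ C.relI R (mediateMap ∘ xs)
    mediateMap-relI R xs =
      ⇔-trans (restrict-relI⇔ R (proj₁ ∘ xs) hasPeriod)
        (⇔-trans (Embedding.hom-rel (ẽ period) R (restrict period ∘ proj₁ ∘ xs))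
                 (relI-cong-⇔ C R (λ j → C.sym (mediateMap-period (xs j) (hasPeriod j)))))
      where
        open CommonPeriod (commonPeriod xs)
        instance K-nonZero : NonZero period
                 K-nonZero = period-nonZero

    mediate : Embedding (PerPower A) C
    mediate = record
      { map       = mediateMap
      ; cong      = λ {x} {y} → mediateMap-cong x y
      ; injective = λ {x} {y} → mediateMap-injective x y
      ; hom-fun   = mediateMap-funI
      ; hom-rel   = mediateMap-relI
      }

    mediate-commute : (n : ℕ) .{{_ : NonZero n}} (x : Fin n → A.Carrier) →
                      C._≈_ (mediateMap (map (extendCone n) x)) (map (ẽ n) x)
    -- The instance inside mediateMap is >-nonZero (>-nonZero⁻¹ n), which a fresh
    -- instance meta would not unify with; passing the one in scope is fine by irrelevance.
    mediate-commute n x = Embedding.cong (ẽ n {{it}}) (A.reflexive ∘ restrict-extend n x)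

    mediate-unique : (h : Embedding (PerPower A) C) →
                     ((n : ℕ) .{{_ : NonZero n}} (x : Fin n → A.Carrier) →
                        C._≈_ (map h (map (extendCone n) x)) (map (ẽ n) x)) →
                     ∀ y → C._≈_ (map h y) (mediateMap y)
    mediate-unique h h-commutes (a , k , k≥1 , hk) =
      C.trans (Embedding.cong h (A.sym ∘ extend-restrict hk)) (h-commutes k (restrict k a))
      where instance k-nonZero : NonZero k
                     k-nonZero = >-nonZero k≥1

proposition4p7 : {c ℓ r : Level} (σ : Signature) (A : Structure σ c ℓ r) →
    IsDirectLimit A (PerPower A)
proposition4p7 σ A = record
  { cone    = extendCone A
  ; isCone  = extendCone-isCone A
  ; mediate = mediate A
  ; commute = mediate-commute A
  ; unique  = mediate-unique A
  }
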